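{- Let $1\le m\le n$ and $\pi_2,\dots,\pi_m\in\{1,\dots,n\}$, and let $A_{\pi_2,\dots,\pi_m}=\{j\in\{1,\dots,n\}:(j,\pi_2,\dots,\pi_m)\in\mathrm{PF}(m,n)\}$. If $A_{\pi_2,\dots,\pi_m}=\{1,\dots,k\}$ for some $k\ge1$, then $k\ge n-m+1$.
   Context: $\mathrm{PF}(m,n)$ is the set of sequences $\pi=(\pi_1,\dots,\pi_m)\in\{1,\dots,n\}^m$ such that, when spots $1,\dots,n$ are initially empty and for $i=1,\dots,m$ in turn car $i$ parks in the first empty spot among $\pi_i,\pi_i+1,\dots,n$, every car parks. -}

module Defs where

open import Data.Nat using (ℕ; zero; suc; _≤_)
open import Data.Bool using (Bool; true; false)
open import Data.List using (List; []; _∷_; length; replicate)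
open import Data.List.Relation.Unary.All using (All)
open import Data.Maybe using (Maybe; just; nothing; map; _>>=_; Is-just)
open import Data.Product using (_×_)
open import Relation.Binary.PropositionalEquality using (_≡_)

-- Occupancy of spots 1..n as a list of Booleans (true = occupied);
-- the head of the list is spot 1.

-- Park a car preferring spot p (1-based) on the spot list: it takes the
-- first empty spot among p, p+1, ..., n; returns nothing if there is none.
-- (p = 0 is treated like p = 1; preferences are constrained to 1..n anyway.)
parkFrom : ℕ → List Bool → Maybe (List Bool)
parkFrom _ [] = nothing
parkFrom zero (false ∷ s) = just (true ∷ s)
parkFrom zero (true ∷ s) = map (true ∷_) (parkFrom zero s)
parkFrom (suc zero) s = parkFrom zero s
parkFrom (suc (suc p)) (b ∷ s) = map (b ∷_) (parkFrom (suc p) s)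

runCars : List ℕ → List Bool → Maybe (List Bool)
runCars [] s = just s
runCars (p ∷ ps) s = parkFrom p s >>= runCars ps

InRange : ℕ → List ℕ → Set
InRange n π = All (λ x → 1 ≤ x × x ≤ n) π

IsPF : ℕ → ℕ → List ℕ → Set
IsPF m n π = (length π ≡ m) × InRange n π × Is-just (runCars π (replicate n false))

-- Hall-type criterion for parking: cars with preferences ps all park from a state s iff, for
-- every spot i, at most the number of empty spots ≥ i of them prefer a spot ≥ i. Hence the first
-- car's preference p may be changed to any q such that the empty spots from q on can hold all
-- the cars. If k ≤ n − m, the m spots k + 1, …, n can, so (1, π₂, …, πₘ) ∈ PF(m,n) yields
-- (k + 1, π₂, …, πₘ) ∈ PF(m,n), i.e. k + 1 ∈ A, contradicting A = {1, …, k}.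
module Submission where

open import Defs
open import Data.Nat using (ℕ; zero; suc; pred; _≤_; _<_; _+_; _∸_; s≤s; s≤s⁻¹; z≤n; _≤?_)
open import Data.Nat.Properties
open import Data.Bool using (Bool; true; false)
open import Data.List using (List; []; _∷_; length; replicate; filter)
open import Data.List.Properties using (length-filter; filter-accept; filter-reject)
open import Data.List.Relation.Unary.All using (_∷_)
open import Data.Maybe using (just; nothing; Is-just)
open import Data.Maybe.Relation.Unary.Any using (just)
open import Data.Product using (_×_; _,_; ∃; proj₂)
open import Data.Sum using (_⊎_; inj₁; inj₂)
open import Data.Unit using (tt)
open import Function.Bundles using (_⇔_; Equivalence)
open import Relation.Nullary using (¬_; yes; no; contradiction)
open import Relation.Binary.PropositionalEquality using (_≡_; refl; sym; cong; subst; subst₂)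

-- Spots and demands are 0-based: a car with preference p wants spot pred p or later
-- (so the junk preference 0 behaves like 1, as in parkFrom).
free : ℕ → List Bool → ℕ
free _ [] = 0
free zero (false ∷ s) = suc (free zero s)
free zero (true ∷ s) = free zero s
free (suc i) (_ ∷ s) = free i s

-- Opaque, so that a later `with i ≤? pred p` cannot abstract inside the unfolded filter.
opaque
  demand : ℕ → List ℕ → ℕ
  demand i ps = length (filter (λ p → i ≤? pred p) ps)

  demand-accept : ∀ {i p} ps → i ≤ pred p → demand i (p ∷ ps) ≡ suc (demand i ps)
  demand-accept {i} ps i≤p = cong length (filter-accept (λ p → i ≤? pred p) {xs = ps} i≤p)

  demand-reject : ∀ {i p} ps → ¬ i ≤ pred p → demand i (p ∷ ps) ≡ demand i ps
  demand-reject {i} ps i≰p = cong length (filter-reject (λ p → i ≤? pred p) {xs = ps} i≰p)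

  demand-≤-length : ∀ i ps → demand i ps ≤ length ps
  demand-≤-length i = length-filter (λ p → i ≤? pred p)

demand-∷ : ∀ i p ps → demand i ps ≤ demand i (p ∷ ps)
demand-∷ i p ps with i ≤? pred p
... | yes i≤p = subst (demand i ps ≤_) (sym (demand-accept ps i≤p)) (n≤1+n _)
... | no i≰p = subst (demand i ps ≤_) (sym (demand-reject ps i≰p)) ≤-refl

demand-antitone : ∀ {i j} → i ≤ j → ∀ ps → demand j ps ≤ demand i ps
demand-antitone {j = j} i≤j [] = ≤-trans (demand-≤-length j []) z≤n
demand-antitone {i} {j} i≤j (p ∷ ps) with j ≤? pred p
... | yes j≤p = subst₂ _≤_ (sym (demand-accept ps j≤p)) (sym (demand-accept ps (≤-trans i≤j j≤p)))
  (s≤s (demand-antitone i≤j ps))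
... | no j≰p = subst (_≤ demand i (p ∷ ps)) (sym (demand-reject ps j≰p))
  (≤-trans (demand-antitone i≤j ps) (demand-∷ i p ps))

free-antitone : ∀ {i j} → i ≤ j → ∀ s → free j s ≤ free i s
free-antitone _ [] = z≤n
free-antitone {zero} {zero} _ (b ∷ s) = ≤-refl
free-antitone {zero} {suc j} _ (false ∷ s) = m≤n⇒m≤1+n (free-antitone z≤n s)
free-antitone {zero} {suc j} _ (true ∷ s) = free-antitone z≤n s
free-antitone {suc i} {suc j} (s≤s i≤j) (_ ∷ s) = free-antitone i≤j s

free-replicate : ∀ n i → free i (replicate n false) ≡ n ∸ i
free-replicate zero zero = refl
free-replicate zero (suc i) = refl
free-replicate (suc n) zero = cong suc (free-replicate n zero)
free-replicate (suc n) (suc i) = free-replicate n i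

data Parks : ℕ → List Bool → List Bool → Set where
  here  : ∀ {s} → Parks zero (false ∷ s) (true ∷ s)
  skip  : ∀ {s s'} → Parks zero s s' → Parks zero (true ∷ s) (true ∷ s')
  later : ∀ {j b s s'} → Parks j s s' → Parks (suc j) (b ∷ s) (b ∷ s')

parkFrom-view : ∀ p s →
  (parkFrom p s ≡ nothing × free (pred p) s ≡ 0) ⊎
  ∃ λ s' → parkFrom p s ≡ just s' × Parks (pred p) s s'
parkFrom-view p [] = inj₁ (refl , refl)
parkFrom-view zero (false ∷ s) = inj₂ (_ , refl , here)
parkFrom-view zero (true ∷ s) with parkFrom zero s | parkFrom-view zero s
... | _ | inj₁ (refl , none) = inj₁ (refl , none)
... | _ | inj₂ (s' , refl , P) = inj₂ (true ∷ s' , refl , skip P)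
parkFrom-view (suc zero) (b ∷ s) = parkFrom-view zero (b ∷ s)
parkFrom-view (suc (suc p)) (b ∷ s) with parkFrom (suc p) s | parkFrom-view (suc p) s
... | _ | inj₁ (refl , none) = inj₁ (refl , none)
... | _ | inj₂ (s' , refl , P) = inj₂ (b ∷ s' , refl , later P)

Parks-free-≤ : ∀ {j s s'} → Parks j s s' → ∀ i → i ≤ j → free i s ≡ suc (free i s')
Parks-free-≤ here zero _ = refl
Parks-free-≤ (skip P) zero _ = Parks-free-≤ P zero z≤n
Parks-free-≤ (later {b = false} P) zero _ = cong suc (Parks-free-≤ P zero z≤n)
Parks-free-≤ (later {b = true} P) zero _ = Parks-free-≤ P zero z≤n
Parks-free-≤ (later P) (suc i) (s≤s i≤j) = Parks-free-≤ P i i≤j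

Parks-free-mono : ∀ {j s s'} → Parks j s s' → ∀ i → free i s' ≤ free i s
Parks-free-mono {s' = s'} P zero = subst (free zero s' ≤_) (sym (Parks-free-≤ P zero z≤n)) (n≤1+n _)
Parks-free-mono here (suc i) = ≤-refl
Parks-free-mono (skip P) (suc i) = Parks-free-mono P i
Parks-free-mono (later P) (suc i) = Parks-free-mono P i

-- Beyond the preferred spot j, the supply is unchanged unless the car parked further on,
-- in which case spots j, …, i − 1 were all taken and free i s equalled free j s.
Parks-free-> : ∀ {j s s'} → Parks j s s' → ∀ i → j < i →
  free i s ≤ free i s' ⊎ suc (free i s') ≡ free j s
Parks-free-> here (suc i) _ = inj₁ ≤-refl
Parks-free-> (skip P) (suc zero) _ = inj₂ (sym (Parks-free-≤ P zero z≤n))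
Parks-free-> (skip P) (suc (suc i)) _ = Parks-free-> P (suc i) (s≤s z≤n)
Parks-free-> (later P) (suc i) (s≤s j<i) = Parks-free-> P i j<i

runCars-sound : ∀ ps s → (∀ i → demand i ps ≤ free i s) → Is-just (runCars ps s)
runCars-sound [] s _ = just tt
runCars-sound (p ∷ ps) s fits with parkFrom-view p s
... | inj₁ (_ , none) =
  contradiction (subst₂ _≤_ (demand-accept ps ≤-refl) none (fits (pred p))) λ ()
... | inj₂ (s' , parked , P) rewrite parked = runCars-sound ps s' fits'
  where
  fits' : ∀ i → demand i ps ≤ free i s'
  fits' i with i ≤? pred p
  ... | yes i≤p = s≤s⁻¹ (subst₂ _≤_ (demand-accept ps i≤p) (Parks-free-≤ P i i≤p) (fits i))
  ... | no i≰p with Parks-free-> P i (≰⇒> i≰p)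
  ...   | inj₁ supply = ≤-trans (demand-∷ i p ps) (≤-trans (fits i) supply)
  ...   | inj₂ taken = s≤s⁻¹ (begin
    suc (demand i ps)             ≤⟨ s≤s (demand-antitone (<⇒≤ (≰⇒> i≰p)) ps) ⟩
    suc (demand (pred p) ps)      ≡⟨ demand-accept ps ≤-refl ⟨
    demand (pred p) (p ∷ ps)      ≤⟨ fits (pred p) ⟩
    free (pred p) s               ≡⟨ taken ⟨
    suc (free i s')               ∎)
    where open ≤-Reasoning

runCars-complete : ∀ ps s → Is-just (runCars ps s) → ∀ i → demand i ps ≤ free i s
runCars-complete [] s _ i = ≤-trans (demand-≤-length i []) z≤n
runCars-complete (p ∷ ps) s runs i with parkFrom-view p s
... | inj₁ (none , _) rewrite none with () ← runs
... | inj₂ (s' , parked , P) rewrite parked with i ≤? pred p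
...   | yes i≤p = subst₂ _≤_ (sym (demand-accept ps i≤p)) (sym (Parks-free-≤ P i i≤p))
  (s≤s (runCars-complete ps s' runs i))
...   | no i≰p = subst (_≤ free i s) (sym (demand-reject ps i≰p))
  (≤-trans (runCars-complete ps s' runs i) (Parks-free-mono P i))

runCars-change-first : ∀ p q ps s → Is-just (runCars (p ∷ ps) s) →
  suc (length ps) ≤ free (pred q) s → Is-just (runCars (q ∷ ps) s)
runCars-change-first p q ps s runs room = runCars-sound (q ∷ ps) s fits
  where
  fits : ∀ i → demand i (q ∷ ps) ≤ free i s
  fits i with i ≤? pred q
  ... | yes i≤q = ≤-trans (demand-≤-length i (q ∷ ps)) (≤-trans room (free-antitone i≤q s))
  ... | no i≰q = subst (_≤ free i s) (sym (demand-reject ps i≰q))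
    (≤-trans (demand-∷ i p ps) (runCars-complete (p ∷ ps) s runs i))

lemma3p1 : (m n : ℕ) → 1 ≤ m → m ≤ n →
    (rest : List ℕ) → length rest ≡ m ∸ 1 → InRange n rest →
    (k : ℕ) → 1 ≤ k →
    ((j : ℕ) → ((1 ≤ j × j ≤ n) × IsPF m n (j ∷ rest)) ⇔ (1 ≤ j × j ≤ k)) →
    n ∸ m + 1 ≤ k
lemma3p1 (suc m) n _ m<n rest len inRange k 1≤k A with n ∸ suc m + 1 ≤? k
... | yes done = done
... | no small = contradiction (proj₂ (Equivalence.to (A (suc k)) ((s≤s z≤n , k<n) , pf))) 1+n≰n
  where
  k+m<n : k + suc m ≤ n
  k+m<n = m≤o∸n⇒m+n≤o k m<n (s≤s⁻¹ (subst (k <_) (+-comm (n ∸ suc m) 1) (≰⇒> small)))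
  k<n : suc k ≤ n
  k<n = m+n≤o⇒m≤o (suc k) (subst (_≤ n) (+-suc k m) k+m<n)
  room : suc (length rest) ≤ free (pred (suc k)) (replicate n false)
  room = subst₂ _≤_ (cong suc (sym len)) (sym (free-replicate n k))
    (m+n≤o⇒m≤o∸n (suc m) (subst (_≤ n) (+-comm k (suc m)) k+m<n))
  runs : Is-just (runCars (suc k ∷ rest) (replicate n false))
  runs = runCars-change-first 1 (suc k) rest (replicate n false)
    (proj₂ (proj₂ (proj₂ (Equivalence.from (A 1) (≤-refl , 1≤k))))) room
  pf : IsPF (suc m) n (suc k ∷ rest)
  pf = cong suc len , (s≤s z≤n , k<n) ∷ inRange , runs
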